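{- Let $G$ be a graph, $(i,j)$ any edge of $G$, and $\bar G=G\setminus\{i,j\}$ (delete $i,j$ and incident edges). Let $x^0$ be an optimal basic feasible solution of $\mathrm{ELP}(G)$ with objective value $z(x^0)$, and $\bar x$ an optimal basic feasible solution of $\mathrm{ELP}(\bar G)$ with objective value $\bar z(\bar x)$. Then $\bar z(\bar x)\le z(x^0)-1$.
   Context: For a graph $H$, $\mathrm{ELP}(H)$ is the linear program: minimize $\sum_{v\in V(H)} x_v$ subject to $x_u+x_v\ge 1$ for every edge $(u,v)$ of $H$, $\sum_{v\in V(C)} x_v\ge s+1$ for every odd cycle $C$ of $H$ with $2s+1$ vertices, and $x\ge 0$. A basic feasible solution is a vertex of its feasible polyhedron.
   Formalization: The solutions $x^0$ and $\bar x$, and all feasible points against which being basic and being optimal are tested, have rational coordinates. -}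

module Defs where

open import Data.Nat using (ℕ; zero; suc; _≤_; _+_)
open import Data.Fin using (Fin; zero; suc; inject₁; fromℕ; punchIn; punchOut)
open import Data.Rational using (ℚ; 0ℚ; 1ℚ; ½) renaming (_+_ to _+ℚ_; _*_ to _*ℚ_; _≤_ to _≤ℚ_)
open import Data.Integer using (+_)
open import Data.Rational using (_/_)
open import Data.Product using (_×_)
open import Function.Definitions using (Injective)
open import Relation.Binary.PropositionalEquality using (_≡_; _≢_; subst)
open import Relation.Nullary using (¬_)

record Graph (n : ℕ) : Set₁ where
  field
    Adj    : Fin n → Fin n → Set
    sym    : ∀ {u v} → Adj u v → Adj v u
    irrefl : ∀ v → ¬ Adj v v
open Graph public

deleteVertex : ∀ {n} → Graph (suc n) → Fin (suc n) → Graph n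
deleteVertex G i = record
  { Adj    = λ u v → Adj G (punchIn i u) (punchIn i v)
  ; sym    = sym G
  ; irrefl = λ v → irrefl G (punchIn i v)
  }

edge-distinct : ∀ {n} (G : Graph n) {i j : Fin n} → Adj G i j → i ≢ j
edge-distinct G {i} {j} e eq = irrefl G j (subst (λ k → Adj G k j) eq e)

deleteEdgeEnds : ∀ {n} (G : Graph (suc (suc n))) (i j : Fin (suc (suc n)))
               → Adj G i j → Graph n
deleteEdgeEnds G i j e = deleteVertex (deleteVertex G i) (punchOut (edge-distinct G e))

Σℚ : ∀ {m} → (Fin m → ℚ) → ℚ
Σℚ {zero}  f = 0ℚ
Σℚ {suc m} f = f zero +ℚ Σℚ (λ k → f (suc k))

IsOddCycle : ∀ {n} → Graph n → (s : ℕ) → (Fin (suc (s + s)) → Fin n) → Set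
IsOddCycle G s c =
  1 ≤ s × Injective _≡_ _≡_ c
  × (∀ (k : Fin (s + s)) → Adj G (c (inject₁ k)) (c (suc k)))
  × Adj G (c (fromℕ (s + s))) (c zero)

ELPFeasible : ∀ {n} → Graph n → (Fin n → ℚ) → Set
ELPFeasible H x =
  (∀ u v → Adj H u v → 1ℚ ≤ℚ (x u +ℚ x v))
  × (∀ s (c : Fin (suc (s + s)) → Fin _) → IsOddCycle H s c
       → (+ (suc s) / 1) ≤ℚ Σℚ (λ k → x (c k)))
  × (∀ v → 0ℚ ≤ℚ x v)

objective : ∀ {n} → (Fin n → ℚ) → ℚ
objective x = Σℚ x

-- Basic feasible solution = vertex (extreme point) of the feasible polyhedron:
-- feasible, and not the midpoint of two distinct feasible points.
IsBFS : ∀ {n} → Graph n → (Fin n → ℚ) → Set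
IsBFS H x =
  ELPFeasible H x
  × (∀ y z → ELPFeasible H y → ELPFeasible H z
       → (∀ v → x v ≡ ½ *ℚ (y v +ℚ z v)) → ∀ v → y v ≡ z v)

IsOptimalBFS : ∀ {n} → Graph n → (Fin n → ℚ) → Set
IsOptimalBFS H x = IsBFS H x × (∀ y → ELPFeasible H y → objective x ≤ℚ objective y)

module Submission where

-- The vertices of
-- Ḡ = G \ {i, j} embed into G by an injective, adjacency-preserving map
-- (two successive punchIns), and every ELP constraint of Ḡ -- edge, odd
-- cycle, or non-negativity -- is the image of an ELP constraint of G.
-- Hence the restriction y of x⁰ to Ḡ is feasible for ELP(Ḡ).  Splitting the
-- objective sum, z(x⁰) = (x⁰ᵢ + x⁰ⱼ) + z̄(y), and the edge constraint
-- x⁰ᵢ + x⁰ⱼ ≥ 1 gives z̄(y) ≤ z(x⁰) - 1.  Optimality of x̄ then yields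
-- z̄(x̄) ≤ z̄(y) ≤ z(x⁰) - 1.

open import Defs hiding (sym)
open import Data.Nat using (ℕ; suc) renaming (_+_ to _+ℕ_)
open import Data.Fin using (Fin; zero; suc; punchIn; punchOut)
open import Data.Fin.Properties using (punchIn-injective; punchIn-punchOut)
open import Data.Rational using (ℚ; 1ℚ; _+_; _-_; _≤_)
open import Data.Rational.Properties
  using (+-assoc; +-comm; +-monoˡ-≤; +-0-group; module ≤-Reasoning)
open import Algebra.Properties.Group +-0-group using (//-rightDividesʳ)
open import Data.Product using (_×_; _,_; proj₁)
open import Function using (_∘_)
open import Function.Definitions using (Injective)
open import Relation.Binary.PropositionalEquality
  using (_≡_; _≢_; refl; sym; cong; module ≡-Reasoning)

Σℚ-punchIn : ∀ {m} (f : Fin (suc m) → ℚ) (p : Fin (suc m))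
           → Σℚ f ≡ f p + Σℚ (f ∘ punchIn p)
Σℚ-punchIn f zero = refl
Σℚ-punchIn {suc m} f (suc p) = begin
  f zero + Σℚ (f ∘ suc)                           ≡⟨ cong (f zero +_) (Σℚ-punchIn (f ∘ suc) p) ⟩
  f zero + (f (suc p) + Σℚ (f ∘ suc ∘ punchIn p)) ≡⟨ sym (+-assoc (f zero) (f (suc p)) _) ⟩
  (f zero + f (suc p)) + Σℚ (f ∘ suc ∘ punchIn p) ≡⟨ cong (_+ Σℚ (f ∘ suc ∘ punchIn p)) (+-comm (f zero) (f (suc p))) ⟩
  (f (suc p) + f zero) + Σℚ (f ∘ suc ∘ punchIn p) ≡⟨ +-assoc (f (suc p)) (f zero) _ ⟩
  f (suc p) + (f zero + Σℚ (f ∘ suc ∘ punchIn p)) ∎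
  where open ≡-Reasoning

-- Removing two distinct points i ≠ j: the remaining points are enumerated by
-- punchIn i ∘ punchIn (punchOut i≢j), exactly as in deleteEdgeEnds.
Σℚ-punchIn₂ : ∀ {m} (f : Fin (suc (suc m)) → ℚ) {i j : Fin (suc (suc m))} (i≢j : i ≢ j)
            → Σℚ f ≡ (f i + f j) + Σℚ (f ∘ punchIn i ∘ punchIn (punchOut i≢j))
Σℚ-punchIn₂ f {i} {j} i≢j = begin
  Σℚ f                                             ≡⟨ Σℚ-punchIn f i ⟩
  f i + Σℚ (f ∘ punchIn i)                         ≡⟨ cong (f i +_) (Σℚ-punchIn (f ∘ punchIn i) j′) ⟩
  f i + (f (punchIn i j′) + Σℚ (f ∘ punchIn i ∘ punchIn j′))
    ≡⟨ cong (λ a → f i + (a + Σℚ (f ∘ punchIn i ∘ punchIn j′))) (cong f (punchIn-punchOut i≢j)) ⟩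
  f i + (f j + Σℚ (f ∘ punchIn i ∘ punchIn j′))    ≡⟨ sym (+-assoc (f i) (f j) _) ⟩
  (f i + f j) + Σℚ (f ∘ punchIn i ∘ punchIn j′)    ∎
  where
  open ≡-Reasoning
  j′ = punchOut i≢j

IsSubgraphEmbedding : ∀ {m n} → Graph m → Graph n → (Fin m → Fin n) → Set
IsSubgraphEmbedding H G φ = Injective _≡_ _≡_ φ × (∀ u v → Adj H u v → Adj G (φ u) (φ v))

oddCycle-map : ∀ {m n} (H : Graph m) (G : Graph n) {φ : Fin m → Fin n}
             → IsSubgraphEmbedding H G φ
             → ∀ s (c : Fin (suc (s +ℕ s)) → Fin m) → IsOddCycle H s c → IsOddCycle G s (φ ∘ c)
oddCycle-map H G (φ-inj , φ-adj) s c (1≤s , c-inj , c-path , c-close) =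
  1≤s , c-inj ∘ φ-inj , (λ k → φ-adj _ _ (c-path k)) , φ-adj _ _ c-close

-- Every ELP(H) constraint is the image of an ELP(G) constraint, so feasible
-- solutions of ELP(G) restrict to feasible solutions of ELP(H).
feasible-restrict : ∀ {m n} (H : Graph m) (G : Graph n) {φ : Fin m → Fin n}
                  → IsSubgraphEmbedding H G φ
                  → ∀ {x} → ELPFeasible G x → ELPFeasible H (x ∘ φ)
feasible-restrict H G emb@(_ , φ-adj) (edges , cycles , nonneg) =
    (λ u v uv → edges _ _ (φ-adj u v uv))
  , (λ s c cyc → cycles s _ (oddCycle-map H G emb s c cyc))
  , (λ v → nonneg _)

deleteEdgeEnds-embedding : ∀ {n} (G : Graph (suc (suc n))) (i j : Fin (suc (suc n)))
                           (e : Adj G i j)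
                         → IsSubgraphEmbedding (deleteEdgeEnds G i j e) G
                             (punchIn i ∘ punchIn (punchOut (edge-distinct G e)))
deleteEdgeEnds-embedding G i j e =
  (λ {u} {v} eq → punchIn-injective j′ u v (punchIn-injective i _ _ eq)) , (λ u v uv → uv)
  where j′ = punchOut (edge-distinct G e)

≤-minus-one : ∀ {a S T : ℚ} → 1ℚ ≤ a → T ≡ a + S → S ≤ T - 1ℚ
≤-minus-one {a} {S} {T} 1≤a T≡a+S = begin
  S                ≡⟨ sym (//-rightDividesʳ 1ℚ S) ⟩
  (S + 1ℚ) - 1ℚ    ≡⟨ cong (_- 1ℚ) (+-comm S 1ℚ) ⟩
  (1ℚ + S) - 1ℚ    ≤⟨ +-monoˡ-≤ _ (+-monoˡ-≤ S 1≤a) ⟩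
  (a + S) - 1ℚ     ≡⟨ cong (_- 1ℚ) (sym T≡a+S) ⟩
  T - 1ℚ           ∎
  where open ≤-Reasoning

lemma7 : (n : ℕ) (G : Graph (suc (suc n))) (i j : Fin (suc (suc n)))
         (e : Adj G i j) (x⁰ : Fin (suc (suc n)) → ℚ) (x̄ : Fin n → ℚ)
       → IsOptimalBFS G x⁰
       → IsOptimalBFS (deleteEdgeEnds G i j e) x̄
       → objective x̄ ≤ objective x⁰ - 1ℚ
lemma7 n G i j e x⁰ x̄ ((x⁰-feasible , _) , _) (_ , x̄-optimal) = begin
  objective x̄        ≤⟨ x̄-optimal y y-feasible ⟩
  objective y        ≤⟨ ≤-minus-one (proj₁ x⁰-feasible i j e) (Σℚ-punchIn₂ x⁰ (edge-distinct G e)) ⟩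
  objective x⁰ - 1ℚ  ∎
  where
  open ≤-Reasoning
  y : Fin n → ℚ
  y = x⁰ ∘ punchIn i ∘ punchIn (punchOut (edge-distinct G e))

  y-feasible : ELPFeasible (deleteEdgeEnds G i j e) y
  y-feasible = feasible-restrict (deleteEdgeEnds G i j e) G (deleteEdgeEnds-embedding G i j e) x⁰-feasible
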